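{- Let $r\geq 2$, $s,t\geq1$ with $st\geq 2$ and $\gcd(s,t)=1$, and $\lambda\geq 1$, and let $\Gamma=Q(r,s,t)^{(\lambda)}$. Then $\Gamma$ has a symmetrical Euler cycle $C$ with $H(C)=\langle\varphi^2,\tau\rangle$.
   Context: Graphs are finite, loopless, possibly with multiple edges; automorphisms permute $V\cup E$ preserving $V$, $E$ and incidence; $\Gamma^{(\lambda)}$ replaces each edge by $\lambda$ parallel edges. $Q(r,s,t)=\mathbf{C}_{2r}[s\mathbf{K}_1,t\mathbf{K}_1]$: vertex set a disjoint union $\bigcup_{m\in\mathbb{Z}_{2r}}U_m$ with $|U_m|=s$ for $m$ even and $|U_m|=t$ for $m$ odd, exactly one edge joining each vertex of $U_m$ to each vertex of $U_{m+1}$ for every $m\in\mathbb{Z}_{2r}$, and no other edges. A cycle of length $\ell$ is a sequence $C=(e_1,\dots,e_\ell)$ of pairwise distinct edges with vertices $\alpha_0,\dots,\alpha_\ell=\alpha_0$ such that $e_i$ is incident with $\alpha_{i-1},\alpha_i$; Euler cycle: contains every edge. On $E(C)$: $\varphi:e_i\mapsto e_{i+1}$, $\tau:e_i\mapsto e_{\ell+1-i}$ (indices mod $\ell$), $D(C)=\langle\varphi,\tau\rangle$. $H(C)$ is the group of restrictions to $E(C)$ of automorphisms leaving $E(C)$ invariant and restricting to elements of $D(C)$. $C$ is symmetrical if $\varphi^2\in H(C)$. -}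

module Defs where

open import Data.Nat as ℕ using (ℕ; zero; suc; _*_; _<?_)
open import Data.Fin as Fin using (Fin; toℕ; fromℕ<; opposite)
open import Data.Bool using (Bool; true; false; if_then_else_)
open import Data.Product using (Σ; Σ-syntax; ∃; ∃-syntax; _×_; _,_)
open import Data.Sum using (_⊎_)
open import Data.List using (List; _∷_; [])
open import Data.List.Membership.Propositional using (_∈_)
open import Function using (_∘_; id; Injective)
open import Function.Bundles using (_↔_; Inverse)
open import Relation.Binary.PropositionalEquality using (_≡_)
open import Relation.Nullary using (yes; no)

sucMod : ∀ {n} → Fin n → Fin n
sucMod {suc n} i with toℕ i <? n
... | yes p = fromℕ< (ℕ.s≤s p)
... | no _  = Fin.zero

isEven : ℕ → Bool
isEven zero = true
isEven (suc n) with isEven n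
... | true = false
... | false = true

_⇔_ : Set → Set → Set
A ⇔ B = (A → B) × (B → A)

-- Multigraphs: each edge has two ends (src/tgt are just a listing of the
-- unordered pair of ends); multiple edges allowed.

record Graph : Set₁ where
  field
    V   : Set
    E   : Set
    src : E → V
    tgt : E → V

  Inc : V → E → Set
  Inc v e = (src e ≡ v) ⊎ (tgt e ≡ v)

  Joins : E → V → V → Set
  Joins e a b = (src e ≡ a × tgt e ≡ b) ⊎ (src e ≡ b × tgt e ≡ a)

open Graph public

-- Γ^(k): each edge replaced by k parallel edges
blowup : ℕ → Graph → Graph
blowup k Γ = record
  { V = V Γ
  ; E = E Γ × Fin k
  ; src = λ { (e , _) → src Γ e }
  ; tgt = λ { (e , _) → tgt Γ e } }

-- Q(r,s,t) = C_{2r}[s K₁, t K₁]; vertex (m , u) is u ∈ U_m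
Q : ℕ → ℕ → ℕ → Graph
Q r s t = record
  { V = Σ (Fin (2 * r)) (λ m → Fin (size m))
  ; E = Σ (Fin (2 * r)) (λ m → Fin (size m) × Fin (size (sucMod m)))
  ; src = λ { (m , u , w) → (m , u) }
  ; tgt = λ { (m , u , w) → (sucMod m , w) } }
  where
  size : Fin (2 * r) → ℕ
  size m = if isEven (toℕ m) then s else t

record Aut (Γ : Graph) : Set where
  field
    vmap : V Γ ↔ V Γ
    emap : E Γ ↔ E Γ
    inc  : ∀ v e → Inc Γ v e ⇔ Inc Γ (Inverse.to vmap v) (Inverse.to emap e)

-- A cycle of length ℓ, 0-indexed: edge i = e_{i+1}, vert i = α_i,
-- and edge i joins vert i and vert (i+1 mod ℓ).
record Cycle (Γ : Graph) (ℓ : ℕ) : Set where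
  field
    edge     : Fin ℓ → E Γ
    distinct : Injective _≡_ _≡_ edge
    vert     : Fin ℓ → V Γ
    joins    : ∀ i → Joins Γ (edge i) (vert i) (vert (sucMod i))

open Cycle public

module _ {Γ : Graph} {ℓ : ℕ} (C : Cycle Γ ℓ) where

  InEC : E Γ → Set
  InEC x = ∃[ i ] edge C i ≡ x

  EulerCycle : Set
  EulerCycle = ∀ x → InEC x

-- Permutations of E(C) are described by their action on positions:
-- π represents the map e_i ↦ e_{π i}.
-- φ : e_i ↦ e_{i+1},  τ : e_i ↦ e_{ℓ+1-i}  (0-indexed: j ↦ ℓ-1-j)
φ : ∀ {ℓ} → Fin ℓ → Fin ℓ
φ = sucMod

τ : ∀ {ℓ} → Fin ℓ → Fin ℓ
τ = opposite

-- subgroup generated by a list S of permutations (elements up to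
-- pointwise equality)
data Gen {ℓ : ℕ} (S : List (Fin ℓ → Fin ℓ)) : (Fin ℓ → Fin ℓ) → Set where
  gen  : ∀ {f} → f ∈ S → Gen S f
  unit : Gen S id
  comp : ∀ {f g} → Gen S f → Gen S g → Gen S (f ∘ g)
  inv  : ∀ {f g} → Gen S f → (∀ x → f (g x) ≡ x) → (∀ x → g (f x) ≡ x) → Gen S g
  ext  : ∀ {f g} → Gen S f → (∀ x → f x ≡ g x) → Gen S g

module _ {Γ : Graph} {ℓ : ℕ} (C : Cycle Γ ℓ) where

  InD : (Fin ℓ → Fin ℓ) → Set
  InD = Gen (φ ∷ τ ∷ [])

  InH : (Fin ℓ → Fin ℓ) → Set
  InH π = Σ[ g ∈ Aut Γ ]
      ((∀ x → InEC C x ⇔ InEC C (Inverse.to (Aut.emap g) x))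
    × (∀ i → Inverse.to (Aut.emap g) (edge C i) ≡ edge C (π i))
    × InD π)

  Symmetrical : Set
  Symmetrical = InH (φ ∘ φ)

-- Index the cycle by ℤ/ℓ with ℓ = 2r·s·t·k.  Position x carries the vertex (x mod 2r, ⌊x/2r⌋ mod |U_x|),
-- so a vertex recurs exactly along a residue class modulo 2r·|U_x|, and edge x joins the vertices at x and
-- x + 1.  As gcd(s, t) = 1, these two vertices determine x modulo 2r·s·t (Chinese remainder theorem), so
-- giving edge x the parallel copy ⌊x/2rst⌋ mod k makes all ℓ edges distinct; Γ has exactly ℓ edges, so the
-- cycle is Euler.
-- Every element of D(C) is an affine map x ↦ ±x + c of ℤ/ℓ, and an automorphism inducing it moves vertex
-- positions by an affine map of the same kind.  If that map preserves parity it respects the residue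
-- classes above, hence is induced by an automorphism; such maps form exactly ⟨φ², τ⟩.  If it reverses
-- parity it carries classes modulo 2r·|U_x| to classes modulo 2r·|U_{x+1}|, forcing t ∣ s and s ∣ t,
-- which is impossible for coprime s, t with st ≥ 2.

module Submission where

open import Defs
open import Data.Bool using (true; false; not; if_then_else_)
open import Data.Empty using (⊥; ⊥-elim)
open import Data.Fin as Fin using (Fin; toℕ; fromℕ<; opposite; cast; combine; punchOut)
open import Data.Fin.Properties
  using (toℕ-injective; toℕ<n; toℕ-fromℕ<; toℕ-cast; opposite-prop; opposite-involutive;
         combine-injectiveˡ; combine-injectiveʳ; pigeonhole; punchOut-injective; any?)
open import Data.List using (List; _∷_; [])
open import Data.List.Membership.Propositional using (_∈_)
open import Data.List.Relation.Unary.Any using (here; there)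
open import Data.Nat
open import Data.Nat.Coprimality as Coprimality using (Coprime; coprime-divisor; gcd≡1⇒coprime)
open import Data.Nat.DivMod hiding (_mod_)
open import Data.Nat.Divisibility
open import Data.Nat.GCD using (gcd)
open import Data.Nat.Properties
open import Data.Nat.Tactic.RingSolver
open import Data.Product
open import Data.Sum using (_⊎_; inj₁; inj₂; [_,_]′) renaming (swap to ⊎-swap; map to ⊎-map)
open import Function using (_∘_; id; Injective)
open import Function.Bundles using (_↔_; Inverse; mk↔ₛ′)
open import Function.Construct.Composition using (_↔-∘_)
open import Function.Construct.Identity using (↔-id)
open import Function.Construct.Symmetry using (↔-sym)
open import Relation.Binary.Bundles using (Setoid)
open import Relation.Binary.PropositionalEquality
import Relation.Binary.Reasoning.Setoid as SetoidReasoning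
open import Relation.Nullary using (¬_; yes; no)

-- Congruences

infix 4 _≡_mod_
data _≡_mod_ (x y d : ℕ) : Set where
  congruent : ∀ a b → x + d * a ≡ y + d * b → x ≡ y mod d

module _ {d : ℕ} where

  mod-refl : ∀ {x} → x ≡ x mod d
  mod-refl = congruent 0 0 refl

  mod-reflexive : ∀ {x y} → x ≡ y → x ≡ y mod d
  mod-reflexive refl = mod-refl

  mod-sym : ∀ {x y} → x ≡ y mod d → y ≡ x mod d
  mod-sym (congruent a b e) = congruent b a (sym e)

  mod-trans : ∀ {x y z} → x ≡ y mod d → y ≡ z mod d → x ≡ z mod d
  mod-trans {x} {y} {z} (congruent a b e) (congruent a′ b′ e′) = congruent (a + a′) (b′ + b) (begin
    x + d * (a + a′)      ≡⟨ solve (x ∷ d ∷ a ∷ a′ ∷ []) ⟩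
    (x + d * a) + d * a′  ≡⟨ cong (_+ d * a′) e ⟩
    (y + d * b) + d * a′  ≡⟨ solve (y ∷ d ∷ b ∷ a′ ∷ []) ⟩
    (y + d * a′) + d * b  ≡⟨ cong (_+ d * b) e′ ⟩
    (z + d * b′) + d * b  ≡⟨ solve (z ∷ d ∷ b′ ∷ b ∷ []) ⟩
    z + d * (b′ + b)      ∎)
    where open ≡-Reasoning

  +-mod : ∀ {x y u v} → x ≡ y mod d → u ≡ v mod d → x + u ≡ y + v mod d
  +-mod {x} {y} {u} {v} (congruent a b e) (congruent a′ b′ e′) = congruent (a + a′) (b + b′) (begin
    x + u + d * (a + a′)      ≡⟨ solve (x ∷ u ∷ d ∷ a ∷ a′ ∷ []) ⟩
    (x + d * a) + (u + d * a′) ≡⟨ cong₂ _+_ e e′ ⟩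
    (y + d * b) + (v + d * b′) ≡⟨ solve (y ∷ v ∷ d ∷ b ∷ b′ ∷ []) ⟩
    y + v + d * (b + b′)      ∎)
    where open ≡-Reasoning

  +-congˡ-mod : ∀ c {x y} → x ≡ y mod d → c + x ≡ c + y mod d
  +-congˡ-mod c = +-mod (mod-refl {c})

  +-congʳ-mod : ∀ c {x y} → x ≡ y mod d → x + c ≡ y + c mod d
  +-congʳ-mod c p = +-mod p (mod-refl {c})

  +-cancelʳ-mod : ∀ {x y} c → x + c ≡ y + c mod d → x ≡ y mod d
  +-cancelʳ-mod {x} {y} c (congruent a b e) = congruent a b (+-cancelˡ-≡ c _ _ (begin
    c + (x + d * a) ≡⟨ solve (c ∷ x ∷ d ∷ a ∷ []) ⟩
    x + c + d * a   ≡⟨ e ⟩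
    y + c + d * b   ≡⟨ solve (y ∷ c ∷ d ∷ b ∷ []) ⟩
    c + (y + d * b) ∎))
    where open ≡-Reasoning

  +-cancelˡ-mod : ∀ {x y} c → c + x ≡ c + y mod d → x ≡ y mod d
  +-cancelˡ-mod {x} {y} c p =
    +-cancelʳ-mod c (subst₂ (_≡_mod d) (+-comm c x) (+-comm c y) p)

  +-multiple-mod : ∀ x a → x + d * a ≡ x mod d
  +-multiple-mod x a = congruent 0 a (trans (cong (x + d * a +_) (*-zeroʳ d)) (+-identityʳ _))

  mod⇒∣ : ∀ {x δ} → x ≡ x + δ mod d → d ∣ δ
  mod⇒∣ {x} {δ} (congruent a b e) = divides (a ∸ b) (begin
    δ                 ≡⟨ m+n∸n≡m δ (d * b) ⟨
    δ + d * b ∸ d * b ≡⟨ cong (_∸ d * b) (+-cancelˡ-≡ x _ _ (trans (sym (+-assoc x δ (d * b))) (sym e))) ⟩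
    d * a ∸ d * b     ≡⟨ *-distribˡ-∸ d a b ⟨
    d * (a ∸ b)       ≡⟨ *-comm d (a ∸ b) ⟩
    (a ∸ b) * d       ∎)
    where open ≡-Reasoning

  ∣⇒mod : ∀ {x δ} → d ∣ δ → x ≡ x + δ mod d
  ∣⇒mod {x} (divides q refl) = mod-sym (subst (λ z → x + z ≡ x mod d) (*-comm d q) (+-multiple-mod x q))

  mod-weaken : ∀ {D x y} → d ∣ D → x ≡ y mod D → x ≡ y mod d
  mod-weaken {x = x} {y} (divides q refl) (congruent a b e) = congruent (q * a) (q * b) (begin
    x + d * (q * a) ≡⟨ solve (x ∷ d ∷ q ∷ a ∷ []) ⟩
    x + q * d * a   ≡⟨ e ⟩
    y + q * d * b   ≡⟨ solve (y ∷ q ∷ d ∷ b ∷ []) ⟩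
    y + d * (q * b) ∎)
    where open ≡-Reasoning

  module _ .{{_ : NonZero d}} where

    %-mod : ∀ x → x % d ≡ x mod d
    %-mod x = congruent (x / d) 0 (begin
      x % d + d * (x / d) ≡⟨ cong (x % d +_) (*-comm d (x / d)) ⟩
      x % d + x / d * d   ≡⟨ m≡m%n+[m/n]*n x d ⟨
      x                   ≡⟨ +-identityʳ x ⟨
      x + 0               ≡⟨ cong (x +_) (*-zeroʳ d) ⟨
      x + d * 0           ∎)
      where open ≡-Reasoning

    mod⇒%≡ : ∀ {x y} → x ≡ y mod d → x % d ≡ y % d
    mod⇒%≡ {x} {y} (congruent a b e) = begin
      x % d               ≡⟨ [m+kn]%n≡m%n x a d ⟨
      (x + a * d) % d     ≡⟨ cong (λ z → (x + z) % d) (*-comm a d) ⟩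
      (x + d * a) % d     ≡⟨ cong (_% d) e ⟩
      (y + d * b) % d     ≡⟨ cong (λ z → (y + z) % d) (*-comm d b) ⟩
      (y + b * d) % d     ≡⟨ [m+kn]%n≡m%n y b d ⟩
      y % d               ∎
      where open ≡-Reasoning


mod-<⇒≡ : ∀ {d x y} → x < d → y < d → x ≡ y mod d → x ≡ y
mod-<⇒≡ {suc _} x<d y<d p = trans (sym (m<n⇒m%n≡m x<d)) (trans (mod⇒%≡ p) (m<n⇒m%n≡m y<d))

mod-setoid : ℕ → Setoid _ _
mod-setoid d = record
  { Carrier = ℕ
  ; _≈_ = _≡_mod d
  ; isEquivalence = record { refl = mod-refl ; sym = mod-sym ; trans = mod-trans } }

module ModReasoning (d : ℕ) = SetoidReasoning (mod-setoid d)

coprime-*-∣ : ∀ m .{{_ : NonZero m}} {s t δ} → Coprime t s →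
              m * s ∣ δ → m * t ∣ δ → m * s * t ∣ δ
coprime-*-∣ m {s} {t} coprime (divides q refl) mt∣δ =
  scale (coprime-divisor coprime (*-cancelˡ-∣ m (subst (m * t ∣_) reassoc mt∣δ)))
  where
  reassoc : q * (m * s) ≡ m * (s * q)
  reassoc = solve (q ∷ m ∷ s ∷ [])
  scale : t ∣ q → m * s * t ∣ q * (m * s)
  scale (divides w refl) = divides w (solve (w ∷ t ∷ m ∷ s ∷ []))

crt : ∀ m .{{_ : NonZero m}} {s t x y} → Coprime t s →
      x ≡ y mod m * s → x ≡ y mod m * t → x ≡ y mod m * s * t
crt m {s} {t} {x} {y} coprime p q =
  [ (λ x≤y → ordered x≤y p q) , (λ y≤x → mod-sym (ordered y≤x (mod-sym p) (mod-sym q))) ]′ (≤-total x y)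
  where
  ordered : ∀ {x y} → x ≤ y → x ≡ y mod m * s → x ≡ y mod m * t → x ≡ y mod m * s * t
  ordered {x} {y} x≤y p q = subst (x ≡_mod m * s * t) (m+[n∸m]≡n x≤y)
    (∣⇒mod (coprime-*-∣ m coprime (mod⇒∣ (subst (x ≡_mod m * s) (sym (m+[n∸m]≡n x≤y)) p))
                                  (mod⇒∣ (subst (x ≡_mod m * t) (sym (m+[n∸m]≡n x≤y)) q))))

mod-combine : ∀ D k .{{_ : NonZero D}} .{{_ : NonZero k}} {x y} →
              x ≡ y mod D → (x / D) % k ≡ (y / D) % k → x ≡ y mod D * k
mod-combine D k {x} {y} p q
  with congruent a b e ← mod-trans (mod-sym (%-mod (x / D))) (subst (_≡ y / D mod k) (sym q) (%-mod (y / D)))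
  = congruent a b (begin
    x + D * k * a                  ≡⟨ cong (_+ D * k * a) (m≡m%n+[m/n]*n x D) ⟩
    x % D + x / D * D + D * k * a  ≡⟨ regroup (x % D) (x / D) a ⟩
    x % D + D * (x / D + k * a)    ≡⟨ cong₂ (λ u v → u + D * v) (mod⇒%≡ p) e ⟩
    y % D + D * (y / D + k * b)    ≡⟨ regroup (y % D) (y / D) b ⟨
    y % D + y / D * D + D * k * b  ≡⟨ cong (_+ D * k * b) (m≡m%n+[m/n]*n y D) ⟨
    y + D * k * b                  ∎)
  where
  open ≡-Reasoning
  regroup : ∀ r q a → r + q * D + D * k * a ≡ r + D * (q + k * a)
  regroup r q a = solve (r ∷ q ∷ a ∷ D ∷ k ∷ [])

shift-mod⇔ : ∀ {d c a p q x y} → p + c ≡ x + a mod d → q + c ≡ y + a mod d → (x ≡ y mod d) ⇔ (p ≡ q mod d)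
shift-mod⇔ {d} {c} {a} P Q =
  (λ x≡y → +-cancelʳ-mod c (mod-trans P (mod-trans (+-congʳ-mod a x≡y) (mod-sym Q)))) ,
  (λ p≡q → +-cancelʳ-mod a (mod-trans (mod-sym P) (mod-trans (+-congʳ-mod c p≡q) Q)))

mirror-mod⇔ : ∀ {d c a p q x y} → p + x + c ≡ a mod d → q + y + c ≡ a mod d → (x ≡ y mod d) ⇔ (p ≡ q mod d)
mirror-mod⇔ {d} {c} {a} {p} {q} {x} {y} P Q =
  (λ x≡y → +-cancelʳ-mod (x + c) (begin
    p + (x + c) ≡⟨ +-assoc p x c ⟨
    p + x + c   ≈⟨ mod-trans P (mod-sym Q) ⟩
    q + y + c   ≈⟨ +-congʳ-mod c (+-congˡ-mod q x≡y) ⟨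
    q + x + c   ≡⟨ +-assoc q x c ⟩
    q + (x + c) ∎)) ,
  (λ p≡q → +-cancelʳ-mod (p + c) (begin
    x + (p + c) ≡⟨ solve (x ∷ p ∷ c ∷ []) ⟩
    p + x + c   ≈⟨ mod-trans P (mod-sym Q) ⟩
    q + y + c   ≡⟨ solve (q ∷ y ∷ c ∷ []) ⟩
    y + (q + c) ≈⟨ +-congˡ-mod y (+-congʳ-mod c p≡q) ⟨
    y + (p + c) ∎))
  where open ModReasoning d

+-*-< : ∀ {a b d z} → a < d → b < z → a + d * b < d * z
+-*-< {a} {b} {d} {z} a<d b<z = begin-strict
  a + d * b <⟨ +-monoˡ-< (d * b) a<d ⟩
  d + d * b ≡⟨ *-suc d b ⟨
  d * suc b ≤⟨ *-monoʳ-≤ d b<z ⟩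
  d * z     ∎
  where open ≤-Reasoning

%-cong : ∀ {a b} x .{{_ : NonZero a}} .{{_ : NonZero b}} → a ≡ b → x % a ≡ x % b
%-cong x refl = refl

coprime-∣⇒≡1 : ∀ {m n} → Coprime m n → m ∣ n → m ≡ 1
coprime-∣⇒≡1 {m} {n} coprime m∣n =
  ∣1⇒≡1 (coprime-divisor coprime (subst (m ∣_) (sym (*-identityʳ n)) m∣n))

isEven-suc : ∀ n → isEven (suc n) ≡ not (isEven n)
isEven-suc n with isEven n
... | true  = refl
... | false = refl

isEven-+2 : ∀ n → isEven (2 + n) ≡ isEven n
isEven-+2 n rewrite isEven-suc (suc n) | isEven-suc n with isEven n
... | true  = refl
... | false = refl

isEven-+-even : ∀ x a → isEven (x + 2 * a) ≡ isEven x
isEven-+-even x zero    = cong isEven (+-identityʳ x)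
isEven-+-even x (suc a) = begin
  isEven (x + 2 * suc a)   ≡⟨ cong isEven shift ⟩
  isEven (2 + (x + 2 * a)) ≡⟨ isEven-+2 (x + 2 * a) ⟩
  isEven (x + 2 * a)       ≡⟨ isEven-+-even x a ⟩
  isEven x                 ∎
  where
  open ≡-Reasoning
  shift : x + 2 * suc a ≡ 2 + (x + 2 * a)
  shift = solve (x ∷ a ∷ [])

isEven-mod2 : ∀ {x y} → x ≡ y mod 2 → isEven x ≡ isEven y
isEven-mod2 {x} {y} (congruent a b e) =
  trans (sym (isEven-+-even x a)) (trans (cong isEven e) (isEven-+-even y b))

mod2-cases : ∀ n → n ≡ 0 mod 2 ⊎ n ≡ 1 mod 2
mod2-cases zero = inj₁ mod-refl
mod2-cases (suc n) with mod2-cases n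
... | inj₁ even = inj₂ (+-congˡ-mod 1 even)
... | inj₂ odd  = inj₁ (mod-trans (+-congˡ-mod 1 odd) (congruent 0 1 refl))

even⇒double : ∀ {n} → n ≡ 0 mod 2 → n ≡ 2 * (n / 2)
even⇒double {n} even = begin
  n                 ≡⟨ m≡m%n+[m/n]*n n 2 ⟩
  n % 2 + n / 2 * 2 ≡⟨ cong (_+ n / 2 * 2) (mod⇒%≡ even) ⟩
  n / 2 * 2         ≡⟨ *-comm (n / 2) 2 ⟩
  2 * (n / 2)       ∎
  where open ≡-Reasoning

toℕ-sucMod : ∀ {n} (i : Fin n) → toℕ (sucMod i) ≡ suc (toℕ i) mod n
toℕ-sucMod {suc n} i with toℕ i <? n
... | yes i<n = mod-reflexive (toℕ-fromℕ< (s≤s i<n))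
... | no  i≮n = mod-sym (subst (λ m → suc m ≡ 0 mod suc n) (sym i≡n) (congruent 0 1 (solve (n ∷ []))))
  where
  i≡n : toℕ i ≡ n
  i≡n = ≤-antisym (≤-pred (toℕ<n i)) (≮⇒≥ i≮n)

toℕ-opposite : ∀ {n} (i : Fin n) → toℕ (opposite i) + toℕ i + 1 ≡ 0 mod n
toℕ-opposite {suc n} i = congruent 0 1 (begin
  toℕ (opposite i) + toℕ i + 1 + suc n * 0 ≡⟨ cong (λ o → o + toℕ i + 1 + suc n * 0) (opposite-prop i) ⟩
  n ∸ toℕ i + toℕ i + 1 + suc n * 0         ≡⟨ cong (λ m → m + 1 + suc n * 0) (m∸n+n≡m (≤-pred (toℕ<n i))) ⟩
  n + 1 + suc n * 0                         ≡⟨ solve (n ∷ []) ⟩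
  suc n * 1                                 ∎)
  where open ≡-Reasoning

toℕ-mod-injective : ∀ {n} {i j : Fin n} → toℕ i ≡ toℕ j mod n → i ≡ j
toℕ-mod-injective {suc n} {i} {j} p = toℕ-injective (mod-<⇒≡ (toℕ<n i) (toℕ<n j) p)

sucMod-injective : ∀ {n} → Injective _≡_ _≡_ (sucMod {n})
sucMod-injective {n} {i} {j} eq = toℕ-mod-injective (+-cancelˡ-mod 1 (begin
  suc (toℕ i)    ≈⟨ toℕ-sucMod i ⟨
  toℕ (sucMod i) ≡⟨ cong toℕ eq ⟩
  toℕ (sucMod j) ≈⟨ toℕ-sucMod j ⟩
  suc (toℕ j)    ∎))
  where open ModReasoning n

cast-injective : ∀ {m n} .(eq : m ≡ n) {i j : Fin m} → cast eq i ≡ cast eq j → i ≡ j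
cast-injective eq {i} {j} p = toℕ-injective (trans (sym (toℕ-cast eq i)) (trans (cong toℕ p) (toℕ-cast eq j)))

-- A value y missed by f lets f, with y punched out, inject Fin (suc n) into Fin n.
injective⇒surjective : ∀ {n} (f : Fin n → Fin n) → Injective _≡_ _≡_ f → ∀ y → ∃ λ x → f x ≡ y
injective⇒surjective {suc n} f f-inj y with any? (λ x → f x Fin.≟ y)
... | yes hit  = hit
... | no  miss = ⊥-elim (collision (pigeonhole (n<1+n n) (λ x → punchOut (y≢f x))))
  where
  y≢f : ∀ x → y ≢ f x
  y≢f x eq = miss (x , sym eq)

  collision : (∃₂ λ i j → i Fin.< j × punchOut (y≢f i) ≡ punchOut (y≢f j)) → ⊥
  collision (i , j , i<j , eq) = <-irrefl (cong toℕ (f-inj (punchOut-injective (y≢f i) (y≢f j) eq))) i<j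

injections⇒surjective : ∀ {n} {A : Set} (f : Fin n → A) (g : A → Fin n) →
  Injective _≡_ _≡_ f → Injective _≡_ _≡_ g → ∀ a → ∃ λ i → f i ≡ a
injections⇒surjective f g f-inj g-inj a =
  map₂ g-inj (injective⇒surjective (g ∘ f) (f-inj ∘ g-inj) (g a))

injective⇒↔ : ∀ {n} (f : Fin n → Fin n) → Injective _≡_ _≡_ f → Fin n ↔ Fin n
injective⇒↔ f f-inj = mk↔ₛ′ f (proj₁ ∘ surj) (proj₂ ∘ surj) (λ x → f-inj (proj₂ (surj (f x))))
  where
  surj : ∀ y → ∃ λ x → f x ≡ y
  surj = injective⇒surjective f f-inj

module _ {n : ℕ} {S : List (Fin n → Fin n)} (P : (Fin n → Fin n) → Set)
  (P-gen     : ∀ {f} → f ∈ S → P f)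
  (P-id      : P id)
  (P-∘       : ∀ {f g} → P f → P g → P (f ∘ g))
  (P-inverse : ∀ {f g} → P f → (∀ x → f (g x) ≡ x) → (∀ x → g (f x) ≡ x) → P g)
  (P-ext     : ∀ {f g} → P f → (∀ x → f x ≡ g x) → P g) where

  Gen-elim : ∀ {f} → Gen S f → P f
  Gen-elim (gen f∈S)   = P-gen f∈S
  Gen-elim unit        = P-id
  Gen-elim (comp p q)  = P-∘ (Gen-elim p) (Gen-elim q)
  Gen-elim (inv p l r) = P-inverse (Gen-elim p) l r
  Gen-elim (ext p e)   = P-ext (Gen-elim p) e

⟨φ²,τ⟩⊆⟨φ,τ⟩ : ∀ {n} {π : Fin n → Fin n} → Gen (φ ∘ φ ∷ τ ∷ []) π → Gen (φ ∷ τ ∷ []) π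
⟨φ²,τ⟩⊆⟨φ,τ⟩ = Gen-elim (Gen (φ ∷ τ ∷ []))
  (λ { (here refl) → comp (gen (here refl)) (gen (here refl)) ; (there (here refl)) → gen (there (here refl)) })
  unit comp inv ext

-- Automorphisms and cycles

⇔-trans : ∀ {A B C : Set} → A ⇔ B → B ⇔ C → A ⇔ C
⇔-trans (f , f⁻¹) (g , g⁻¹) = g ∘ f , f⁻¹ ∘ g⁻¹

SameEnds : {A : Set} → A → A → A → A → Set
SameEnds a b c d = (a ≡ c × b ≡ d) ⊎ (a ≡ d × b ≡ c)

same-ends : ∀ {A : Set} {a b c d w : A} → SameEnds a b c d → (a ≡ w ⊎ b ≡ w) ⇔ (c ≡ w ⊎ d ≡ w)
same-ends (inj₁ (refl , refl)) = id , id
same-ends (inj₂ (refl , refl)) = ⊎-swap , ⊎-swap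

module _ {Γ : Graph} where
  open Inverse

  idᴬ : Aut Γ
  idᴬ = record { vmap = ↔-id _ ; emap = ↔-id _ ; inc = λ _ _ → id , id }

  _∘ᴬ_ : Aut Γ → Aut Γ → Aut Γ
  A ∘ᴬ B = record
    { vmap = Aut.vmap A ↔-∘ Aut.vmap B
    ; emap = Aut.emap A ↔-∘ Aut.emap B
    ; inc  = λ v e → ⇔-trans (Aut.inc B v e) (Aut.inc A _ _) }

  _⁻¹ᴬ : Aut Γ → Aut Γ
  A ⁻¹ᴬ = record
    { vmap = ↔-sym (Aut.vmap A)
    ; emap = ↔-sym (Aut.emap A)
    ; inc  = λ v e → swap (subst₂ (λ v′ e′ → Inc Γ (from (Aut.vmap A) v) (from (Aut.emap A) e) ⇔ Inc Γ v′ e′)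
                                  (strictlyInverseˡ (Aut.vmap A) v) (strictlyInverseˡ (Aut.emap A) e)
                                  (Aut.inc A (from (Aut.vmap A) v) (from (Aut.emap A) e))) }

module _ {Γ : Graph} {n : ℕ} (C : Cycle Γ n) where
  open Inverse

  Induces : Aut Γ → (Fin n → Fin n) → Set
  Induces A π = ∀ i → to (Aut.emap A) (edge C i) ≡ edge C (π i)

  Induced : (Fin n → Fin n) → Set
  Induced π = Σ (Aut Γ) λ A → Induces A π

  Gen-induced : ∀ {S} → (∀ {f} → f ∈ S → Induced f) → ∀ {π} → Gen S π → Induced π
  Gen-induced gens = Gen-elim Induced gens
    (idᴬ , λ _ → refl)
    (λ { {f} {g} (A , A-f) (B , B-g) → A ∘ᴬ B , λ i → trans (cong (to (Aut.emap A)) (B-g i)) (A-f (g i)) })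
    (λ { {f} {g} (A , A-f) f∘g≗id _ → A ⁻¹ᴬ , λ i →
          trans (cong (from (Aut.emap A)) (trans (cong (edge C) (sym (f∘g≗id i))) (sym (A-f (g i)))))
                (strictlyInverseʳ (Aut.emap A) (edge C (g i))) })
    (λ { (A , A-f) f≗g → A , λ i → trans (A-f i) (cong (edge C) (f≗g i)) })

  RespectsVert : (Fin n → Fin n) → Set
  RespectsVert σ = ∀ {i j} → vert C i ≡ vert C j → vert C (σ i) ≡ vert C (σ j)

  euler⇒InH : EulerCycle C → ∀ {π} → Induced π → InD C π → InH C π
  euler⇒InH euler (A , A-π) π∈D = A , (λ x → (λ _ → euler _) , (λ _ → euler x)) , A-π , π∈D

  Inc-edge : ∀ v i → Inc Γ v (edge C i) ⇔ (vert C i ≡ v ⊎ vert C (φ i) ≡ v)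
  Inc-edge v i = same-ends (joins C i)

  common-vertex : (∀ j → vert C j ≢ vert C (φ (φ j))) →
                  ∀ {w j} → Inc Γ w (edge C j) → Inc Γ w (edge C (φ j)) → w ≡ vert C (φ j)
  common-vertex no-return {w} {j} p q with proj₁ (Inc-edge w j) p | proj₁ (Inc-edge w (φ j)) q
  ... | inj₂ e | _       = sym e
  ... | inj₁ _ | inj₁ e  = sym e
  ... | inj₁ e | inj₂ e′ = ⊥-elim (no-return j (trans e (sym e′)))

module _ {Γ : Graph} {n : ℕ} (C : Cycle Γ n) (euler : EulerCycle C)
         (position : V Γ → Fin n) (vert-position : ∀ v → vert C (position v) ≡ v) where
  open Inverse

  private
    index : E Γ → Fin n
    index e = proj₁ (euler e)

    edge-index : ∀ e → edge C (index e) ≡ e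
    edge-index e = proj₂ (euler e)

    index-edge : ∀ i → index (edge C i) ≡ i
    index-edge i = distinct C (edge-index (edge C i))

  vertex↔ : (σ : Fin n ↔ Fin n) → RespectsVert C (to σ) → RespectsVert C (from σ) → V Γ ↔ V Γ
  vertex↔ σ σ-resp σ⁻¹-resp =
    mk↔ₛ′ (λ v → vert C (to σ (position v))) (λ v → vert C (from σ (position v)))
    (λ v → trans (σ-resp (vert-position _)) (trans (cong (vert C) (strictlyInverseˡ σ _)) (vert-position v)))
    (λ v → trans (σ⁻¹-resp (vert-position _)) (trans (cong (vert C) (strictlyInverseʳ σ _)) (vert-position v)))

  edge↔ : Fin n ↔ Fin n → E Γ ↔ E Γ
  edge↔ π = mk↔ₛ′ (λ e → edge C (to π (index e))) (λ e → edge C (from π (index e)))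
    (λ e → trans (cong (edge C ∘ to π) (index-edge _))
                 (trans (cong (edge C) (strictlyInverseˡ π _)) (edge-index e)))
    (λ e → trans (cong (edge C ∘ from π) (index-edge _))
                 (trans (cong (edge C) (strictlyInverseʳ π _)) (edge-index e)))

  cycle-automorphism : (σ π : Fin n ↔ Fin n) → RespectsVert C (to σ) → RespectsVert C (from σ) →
    (∀ i → SameEnds (vert C (to σ i)) (vert C (to σ (φ i))) (vert C (to π i)) (vert C (φ (to π i)))) →
    Induced C (to π)
  cycle-automorphism σ π σ-resp σ⁻¹-resp ends = automorphism , maps-edge
    where
    vmap : V Γ ↔ V Γ
    vmap = vertex↔ σ σ-resp σ⁻¹-resp

    f : V Γ → V Γ
    f = to vmap

    f-vert : ∀ i → f (vert C i) ≡ vert C (to σ i)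
    f-vert i = σ-resp (vert-position (vert C i))

    f-injective : ∀ {v w} → f v ≡ f w → v ≡ w
    f-injective {v} {w} eq =
      trans (sym (strictlyInverseʳ vmap v)) (trans (cong (from vmap) eq) (strictlyInverseʳ vmap w))

    maps-edge : ∀ i → to (edge↔ π) (edge C i) ≡ edge C (to π i)
    maps-edge i = cong (edge C ∘ to π) (index-edge i)

    ends-image : ∀ v i → (vert C i ≡ v ⊎ vert C (φ i) ≡ v) ⇔
                         (vert C (to σ i) ≡ f v ⊎ vert C (to σ (φ i)) ≡ f v)
    ends-image v i = ⊎-map (image i) (image (φ i)) , ⊎-map (preimage i) (preimage (φ i))
      where
      image : ∀ j → vert C j ≡ v → vert C (to σ j) ≡ f v
      image j e = trans (sym (f-vert j)) (cong f e)
      preimage : ∀ j → vert C (to σ j) ≡ f v → vert C j ≡ v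
      preimage j e = f-injective (trans (f-vert j) e)

    Inc-image : ∀ v i → Inc Γ v (edge C i) ⇔ Inc Γ (f v) (to (edge↔ π) (edge C i))
    Inc-image v i = subst (λ e → Inc Γ v (edge C i) ⇔ Inc Γ (f v) e) (sym (maps-edge i))
      (⇔-trans (Inc-edge C v i) (⇔-trans (ends-image v i)
        (⇔-trans (same-ends (ends i)) (swap (Inc-edge C (f v) (to π i))))))

    automorphism : Aut Γ
    automorphism = record
      { vmap = vmap
      ; emap = edge↔ π
      ; inc  = λ v e → subst (λ e → Inc Γ v e ⇔ Inc Γ (f v) (to (edge↔ π) e)) (edge-index e)
                             (Inc-image v (index e)) }

-- Affine maps of ℤ/n

-- Rotations x ↦ x + (a − c) and reflections x ↦ (a − c) − x of ℤ/n, stated without subtraction.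
module _ {n : ℕ} where

  Rotation : ℕ → ℕ → (Fin n → Fin n) → Set
  Rotation c a π = ∀ x → toℕ (π x) + c ≡ toℕ x + a mod n

  Reflection : ℕ → ℕ → (Fin n → Fin n) → Set
  Reflection c a π = ∀ x → toℕ (π x) + toℕ x + c ≡ a mod n

data Affine {n : ℕ} (π : Fin n → Fin n) : Set where
  rotation   : ∀ c a → Rotation c a π → Affine π
  reflection : ∀ c a → Reflection c a π → Affine π

module _ {n : ℕ} where

  offset : ∀ {π : Fin n → Fin n} → Affine π → ℕ
  offset (rotation c a _)   = c + a
  offset (reflection c a _) = c + a

  φ-rotation : Rotation 0 1 (φ {n})
  φ-rotation x = begin
    toℕ (φ x) + 0 ≡⟨ +-identityʳ _ ⟩
    toℕ (φ x)     ≈⟨ toℕ-sucMod x ⟩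
    suc (toℕ x)        ≡⟨ +-comm 1 (toℕ x) ⟩
    toℕ x + 1          ∎
    where open ModReasoning n

  τ-reflection : Reflection 1 0 (τ {n})
  τ-reflection = toℕ-opposite

  module _ {c₁ a₁ c₂ a₂ : ℕ} {f g : Fin n → Fin n} where

    rotation-∘-rotation : Rotation c₁ a₁ f → Rotation c₂ a₂ g → Rotation (c₁ + c₂) (a₁ + a₂) (f ∘ g)
    rotation-∘-rotation F G x = compose {toℕ (f (g x))} {toℕ (g x)} {toℕ x} (F (g x)) (G x)
      where
      compose : ∀ {y z w} → y + c₁ ≡ z + a₁ mod n → z + c₂ ≡ w + a₂ mod n → y + (c₁ + c₂) ≡ w + (a₁ + a₂) mod n
      compose {y} {z} {w} p q = begin
        y + (c₁ + c₂) ≡⟨ solve (y ∷ c₁ ∷ c₂ ∷ []) ⟩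
        y + c₁ + c₂   ≈⟨ +-congʳ-mod c₂ p ⟩
        z + a₁ + c₂   ≡⟨ solve (z ∷ a₁ ∷ c₂ ∷ []) ⟩
        z + c₂ + a₁   ≈⟨ +-congʳ-mod a₁ q ⟩
        w + a₂ + a₁   ≡⟨ solve (w ∷ a₂ ∷ a₁ ∷ []) ⟩
        w + (a₁ + a₂) ∎
        where open ModReasoning n

    rotation-∘-reflection : Rotation c₁ a₁ f → Reflection c₂ a₂ g → Reflection (c₁ + c₂) (a₁ + a₂) (f ∘ g)
    rotation-∘-reflection F G x = compose {toℕ (f (g x))} {toℕ (g x)} {toℕ x} (F (g x)) (G x)
      where
      compose : ∀ {y z w} → y + c₁ ≡ z + a₁ mod n → z + w + c₂ ≡ a₂ mod n → y + w + (c₁ + c₂) ≡ a₁ + a₂ mod n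
      compose {y} {z} {w} p q = begin
        y + w + (c₁ + c₂)  ≡⟨ solve (y ∷ w ∷ c₁ ∷ c₂ ∷ []) ⟩
        y + c₁ + (w + c₂)  ≈⟨ +-congʳ-mod (w + c₂) p ⟩
        z + a₁ + (w + c₂)  ≡⟨ solve (z ∷ a₁ ∷ w ∷ c₂ ∷ []) ⟩
        a₁ + (z + w + c₂)  ≈⟨ +-congˡ-mod a₁ q ⟩
        a₁ + a₂            ∎
        where open ModReasoning n

    reflection-∘-rotation : Reflection c₁ a₁ f → Rotation c₂ a₂ g → Reflection (a₂ + c₁) (a₁ + c₂) (f ∘ g)
    reflection-∘-rotation F G x = compose {toℕ (f (g x))} {toℕ (g x)} {toℕ x} (F (g x)) (G x)
      where
      compose : ∀ {y z w} → y + z + c₁ ≡ a₁ mod n → z + c₂ ≡ w + a₂ mod n → y + w + (a₂ + c₁) ≡ a₁ + c₂ mod n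
      compose {y} {z} {w} p q = begin
        y + w + (a₂ + c₁)  ≡⟨ solve (y ∷ w ∷ a₂ ∷ c₁ ∷ []) ⟩
        y + c₁ + (w + a₂)  ≈⟨ +-congˡ-mod (y + c₁) q ⟨
        y + c₁ + (z + c₂)  ≡⟨ solve (y ∷ c₁ ∷ z ∷ c₂ ∷ []) ⟩
        y + z + c₁ + c₂    ≈⟨ +-congʳ-mod c₂ p ⟩
        a₁ + c₂            ∎
        where open ModReasoning n

    reflection-∘-reflection : Reflection c₁ a₁ f → Reflection c₂ a₂ g → Rotation (c₁ + a₂) (a₁ + c₂) (f ∘ g)
    reflection-∘-reflection F G x = compose {toℕ (f (g x))} {toℕ (g x)} {toℕ x} (F (g x)) (G x)
      where
      compose : ∀ {y z w} → y + z + c₁ ≡ a₁ mod n → z + w + c₂ ≡ a₂ mod n → y + (c₁ + a₂) ≡ w + (a₁ + c₂) mod n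
      compose {y} {z} {w} p q = begin
        y + (c₁ + a₂)         ≈⟨ +-congˡ-mod y (+-congˡ-mod c₁ q) ⟨
        y + (c₁ + (z + w + c₂)) ≡⟨ solve (y ∷ c₁ ∷ z ∷ w ∷ c₂ ∷ []) ⟩
        y + z + c₁ + (w + c₂) ≈⟨ +-congʳ-mod (w + c₂) p ⟩
        a₁ + (w + c₂)         ≡⟨ solve (a₁ ∷ w ∷ c₂ ∷ []) ⟩
        w + (a₁ + c₂)         ∎
        where open ModReasoning n

  affine-∘ : ∀ {f g : Fin n → Fin n} → Affine f → Affine g → Affine (f ∘ g)
  affine-∘ {f} {g} (rotation c₁ a₁ F) (rotation c₂ a₂ G) =
    rotation _ _ (rotation-∘-rotation {c₁} {a₁} {c₂} {a₂} {f} {g} F G)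
  affine-∘ {f} {g} (rotation c₁ a₁ F) (reflection c₂ a₂ G) =
    reflection _ _ (rotation-∘-reflection {c₁} {a₁} {c₂} {a₂} {f} {g} F G)
  affine-∘ {f} {g} (reflection c₁ a₁ F) (rotation c₂ a₂ G) =
    reflection _ _ (reflection-∘-rotation {c₁} {a₁} {c₂} {a₂} {f} {g} F G)
  affine-∘ {f} {g} (reflection c₁ a₁ F) (reflection c₂ a₂ G) =
    rotation _ _ (reflection-∘-reflection {c₁} {a₁} {c₂} {a₂} {f} {g} F G)

  affine-inverse : ∀ {f g : Fin n → Fin n} → Affine f → (∀ x → f (g x) ≡ x) → Affine g
  affine-inverse {f} {g} (rotation c a F) f∘g≗id = rotation a c λ x →
    mod-sym (subst (λ y → toℕ y + c ≡ toℕ (g x) + a mod n) (f∘g≗id x) (F (g x)))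
  affine-inverse {f} {g} (reflection c a F) f∘g≗id = reflection c a λ x →
    subst (λ y → y + c ≡ a mod n) (+-comm (toℕ x) (toℕ (g x)))
      (subst (λ y → toℕ y + toℕ (g x) + c ≡ a mod n) (f∘g≗id x) (F (g x)))

  offset-inverse : ∀ {f g : Fin n → Fin n} (α : Affine f) (f∘g≗id : ∀ x → f (g x) ≡ x) →
                   offset (affine-inverse α f∘g≗id) ≡ offset α
  offset-inverse (rotation c a _)   _ = +-comm a c
  offset-inverse (reflection c a _) _ = refl

  affine-ext : ∀ {f g : Fin n → Fin n} → Affine f → (∀ x → f x ≡ g x) → Affine g
  affine-ext (rotation c a F) f≗g = rotation c a λ x →
    subst (λ y → toℕ y + c ≡ toℕ x + a mod n) (f≗g x) (F x)
  affine-ext (reflection c a F) f≗g = reflection c a λ x →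
    subst (λ y → toℕ y + toℕ x + c ≡ a mod n) (f≗g x) (F x)

  φ²-rotation : Rotation 0 2 (φ ∘ φ)
  φ²-rotation = rotation-∘-rotation {0} {1} {0} {1} {φ} {φ} φ-rotation φ-rotation

  D⇒affine : ∀ {π} → Gen (φ ∷ τ ∷ []) π → Affine π
  D⇒affine = Gen-elim Affine
    (λ { (here refl) → rotation 0 1 φ-rotation ; (there (here refl)) → reflection 1 0 τ-reflection })
    (rotation 0 0 λ _ → mod-refl) affine-∘ (λ α f∘g≗id _ → affine-inverse α f∘g≗id) affine-ext

  affine-mod⇔ : ∀ {π d} → d ∣ n → Affine π → ∀ x y → (toℕ x ≡ toℕ y mod d) ⇔ (toℕ (π x) ≡ toℕ (π y) mod d)
  affine-mod⇔ d∣n (rotation c a F)   x y = shift-mod⇔ (mod-weaken d∣n (F x)) (mod-weaken d∣n (F y))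
  affine-mod⇔ d∣n (reflection c a F) x y = mirror-mod⇔ (mod-weaken d∣n (F x)) (mod-weaken d∣n (F y))

  affine-injective : ∀ {π} → Affine π → Injective _≡_ _≡_ π
  affine-injective α {x} {y} eq = toℕ-mod-injective (proj₂ (affine-mod⇔ ∣-refl α x y) (mod-reflexive (cong toℕ eq)))

  affine-parity : ∀ {π} → 2 ∣ n → (α : Affine π) → ∀ x → toℕ (π x) ≡ toℕ x + offset α mod 2
  affine-parity 2∣n (rotation c a F) x = shifted (mod-weaken 2∣n (F x))
    where
    shifted : ∀ {p x} → p + c ≡ x + a mod 2 → p ≡ x + (c + a) mod 2
    shifted {p} {x} P = begin
      p             ≈⟨ +-multiple-mod p c ⟨
      p + 2 * c     ≡⟨ solve (p ∷ c ∷ []) ⟩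
      p + c + c     ≈⟨ +-congʳ-mod c P ⟩
      x + a + c     ≡⟨ solve (x ∷ a ∷ c ∷ []) ⟩
      x + (c + a)   ∎
      where open ModReasoning 2
  affine-parity 2∣n (reflection c a F) x = mirrored (mod-weaken 2∣n (F x))
    where
    mirrored : ∀ {p x} → p + x + c ≡ a mod 2 → p ≡ x + (c + a) mod 2
    mirrored {p} {x} P = begin
      p                   ≈⟨ +-multiple-mod p (x + c) ⟨
      p + 2 * (x + c)     ≡⟨ solve (p ∷ x ∷ c ∷ []) ⟩
      p + x + c + (x + c) ≈⟨ +-congʳ-mod (x + c) P ⟩
      a + (x + c)         ≡⟨ solve (a ∷ x ∷ c ∷ []) ⟩
      x + (c + a)         ∎
      where open ModReasoning 2

  rotation-φ : ∀ {c a π} → Rotation c a π → ∀ j → π (φ j) ≡ φ (π j)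
  rotation-φ {c} {a} {π} F j = toℕ-mod-injective (+-cancelʳ-mod c (begin
    toℕ (π (φ j)) + c   ≈⟨ F (φ j) ⟩
    toℕ (φ j) + a       ≈⟨ +-congʳ-mod a (toℕ-sucMod j) ⟩
    suc (toℕ j) + a     ≈⟨ +-congˡ-mod 1 (F j) ⟨
    suc (toℕ (π j)) + c ≈⟨ +-congʳ-mod c (toℕ-sucMod (π j)) ⟨
    toℕ (φ (π j)) + c   ∎))
    where open ModReasoning n

  reflection-φ : ∀ {c a π} → Reflection c a π → ∀ j → π j ≡ φ (π (φ j))
  reflection-φ {c} {a} {π} F j = toℕ-mod-injective (+-cancelʳ-mod (toℕ j + c) (begin
    toℕ (π j) + (toℕ j + c)                 ≡⟨ +-assoc (toℕ (π j)) (toℕ j) c ⟨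
    toℕ (π j) + toℕ j + c                   ≈⟨ mod-trans (F j) (mod-sym (F (φ j))) ⟩
    toℕ (π (φ j)) + toℕ (φ j) + c           ≈⟨ +-congʳ-mod c (+-congˡ-mod (toℕ (π (φ j))) (toℕ-sucMod j)) ⟩
    toℕ (π (φ j)) + suc (toℕ j) + c         ≡⟨ trans (cong (_+ c) (+-suc _ (toℕ j))) (cong suc (+-assoc _ (toℕ j) c)) ⟩
    suc (toℕ (π (φ j))) + (toℕ j + c)       ≈⟨ +-congʳ-mod (toℕ j + c) (toℕ-sucMod (π (φ j))) ⟨
    toℕ (φ (π (φ j))) + (toℕ j + c)         ∎))
    where open ModReasoning n

  -- Vertex i of a cycle lies between edges i − 1 and i, so a reflection of the edge positions
  -- moves the vertex positions one step further.
  vertexPart : ∀ {π : Fin n → Fin n} → Affine π → Fin n → Fin n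
  vertexPart {π} (rotation _ _ _)   = π
  vertexPart {π} (reflection _ _ _) = φ ∘ π

  vertexPart-affine : ∀ {π} (α : Affine π) → Affine (vertexPart α)
  vertexPart-affine α@(rotation _ _ _)    = α
  vertexPart-affine {π} (reflection c a F) =
    reflection c (suc a) (rotation-∘-reflection {0} {1} {c} {a} {φ} {π} φ-rotation F)

iterate : ∀ {A : Set} → (A → A) → ℕ → A → A
iterate f zero    = id
iterate f (suc b) = f ∘ iterate f b

module _ {n : ℕ} where

  iterate-rotation : ∀ {c a} {f : Fin n → Fin n} → Rotation c a f → ∀ b → Rotation (b * c) (b * a) (iterate f b)
  iterate-rotation F zero    _ = mod-refl
  iterate-rotation {c} {a} {f} F (suc b) =
    rotation-∘-rotation {n} {c} {a} {b * c} {b * a} {f} {iterate f b} F (iterate-rotation F b)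

  iterate-Gen : ∀ {S} {f : Fin n → Fin n} → Gen S f → ∀ b → Gen S (iterate f b)
  iterate-Gen f∈⟨S⟩ zero    = unit
  iterate-Gen f∈⟨S⟩ (suc b) = comp f∈⟨S⟩ (iterate-Gen f∈⟨S⟩ b)

  module _ .{{_ : NonZero n}} (2∣n : 2 ∣ n) where

    rotation⇒⟨φ²,τ⟩ : ∀ {c a π} → Rotation c a π → c + a ≡ 0 mod 2 → Gen (φ ∘ φ ∷ τ ∷ []) π
    rotation⇒⟨φ²,τ⟩ {c} {a} {π} F even = ext (iterate-Gen (gen (here refl)) b) agree
      where
      -- π x ≡ x + a′, because c + (n ∸ 1) * c = n * c
      a′ b : ℕ
      a′ = a + (n ∸ 1) * c
      b  = a′ / 2

      n*c : ∀ x → x + n * c ≡ x + c + (n ∸ 1) * c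
      n*c x = trans (cong (λ m → x + m * c) (sym (suc-pred n))) (sym (+-assoc x c _))

      a′≡2b : a′ ≡ 2 * b
      a′≡2b = even⇒double (begin
        a + (n ∸ 1) * c             ≈⟨ +-multiple-mod _ c ⟨
        a + (n ∸ 1) * c + 2 * c     ≡⟨ regroup ((n ∸ 1) * c) ⟩
        c + a + c + (n ∸ 1) * c     ≡⟨ n*c (c + a) ⟨
        c + a + n * c               ≈⟨ ∣⇒mod (∣-trans 2∣n (m∣m*n c)) ⟨
        c + a                       ≈⟨ even ⟩
        0                           ∎)
        where
        open ModReasoning 2
        regroup : ∀ m → a + m + 2 * c ≡ c + a + c + m
        regroup m = solve (a ∷ m ∷ c ∷ [])

      agree : ∀ x → iterate (φ ∘ φ) b x ≡ π x
      agree x = toℕ-mod-injective (begin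
        toℕ (iterate (φ ∘ φ) b x)         ≡⟨ +-identityʳ _ ⟨
        toℕ (iterate (φ ∘ φ) b x) + 0     ≡⟨ cong (toℕ (iterate (φ ∘ φ) b x) +_) (*-zeroʳ b) ⟨
        toℕ (iterate (φ ∘ φ) b x) + b * 0 ≈⟨ iterate-rotation φ²-rotation b x ⟩
        toℕ x + b * 2                     ≡⟨ cong (toℕ x +_) (trans (*-comm b 2) (sym a′≡2b)) ⟩
        toℕ x + a′                        ≡⟨ +-assoc (toℕ x) a _ ⟨
        toℕ x + a + (n ∸ 1) * c           ≈⟨ +-congʳ-mod _ (F x) ⟨
        toℕ (π x) + c + (n ∸ 1) * c       ≡⟨ n*c (toℕ (π x)) ⟨
        toℕ (π x) + n * c                 ≈⟨ +-multiple-mod _ c ⟩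
        toℕ (π x)                         ∎)
        where open ModReasoning n

    reflection⇒⟨φ²,τ⟩ : ∀ {c a π} → Reflection c a π → c + suc a ≡ 0 mod 2 → Gen (φ ∘ φ ∷ τ ∷ []) π
    reflection⇒⟨φ²,τ⟩ {c} {a} {π} F even =
      ext (comp (rotation⇒⟨φ²,τ⟩ {c + 0} {a + 1} {π ∘ τ} π∘τ-rotation even′) (gen (there (here refl))))
          (λ x → cong π (opposite-involutive x))
      where
      π∘τ-rotation : Rotation (c + 0) (a + 1) (π ∘ τ)
      π∘τ-rotation = reflection-∘-reflection {n} {c} {a} {1} {0} {π} {τ} F τ-reflection

      even′ : c + 0 + (a + 1) ≡ 0 mod 2
      even′ = subst (_≡ 0 mod 2) regroup even
        where
        regroup : c + suc a ≡ c + 0 + (a + 1)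
        regroup = solve (c ∷ a ∷ [])

    vertex-even⇒⟨φ²,τ⟩ : ∀ {π} (α : Affine π) → offset (vertexPart-affine α) ≡ 0 mod 2 → Gen (φ ∘ φ ∷ τ ∷ []) π
    vertex-even⇒⟨φ²,τ⟩ (rotation c a F)   = rotation⇒⟨φ²,τ⟩ F
    vertex-even⇒⟨φ²,τ⟩ (reflection c a F) = reflection⇒⟨φ²,τ⟩ F

module _ {Γ : Graph} {n : ℕ} (C : Cycle Γ n) (no-return : ∀ j → vert C j ≢ vert C (φ (φ j))) where

  vertex-image : ∀ {π} (A : Aut Γ) → Induces C A π → (α : Affine π) →
                 ∀ i → Inverse.to (Aut.vmap A) (vert C i) ≡ vert C (vertexPart α i)
  vertex-image {π} A A-π α i with j , refl ← injective⇒surjective φ sucMod-injective i = image α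
    where
    w : V Γ
    w = Inverse.to (Aut.vmap A) (vert C (φ j))

    on-edge : ∀ j′ → Inc Γ (vert C (φ j)) (edge C j′) → Inc Γ w (edge C (π j′))
    on-edge j′ inc = subst (Inc Γ w) (A-π j′) (proj₁ (Aut.inc A _ _) inc)

    on-πj : Inc Γ w (edge C (π j))
    on-πj = on-edge j (proj₂ (Inc-edge C _ j) (inj₂ refl))

    on-πφj : Inc Γ w (edge C (π (φ j)))
    on-πφj = on-edge (φ j) (proj₂ (Inc-edge C _ (φ j)) (inj₁ refl))

    image : (α : Affine π) → w ≡ vert C (vertexPart α (φ j))
    image (rotation c a F) =
      trans (common-vertex C no-return on-πj (subst (Inc Γ w ∘ edge C) (rotation-φ {π = π} F j) on-πφj))
            (cong (vert C) (sym (rotation-φ {π = π} F j)))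
    image (reflection c a F) =
      common-vertex C no-return on-πφj (subst (Inc Γ w ∘ edge C) (reflection-φ {π = π} F j) on-πj)

-- The Euler cycle of Q(r,s,t)^(k)

module Construction (r s t k : ℕ) (r≥2 : 2 ≤ r) {{s≢0 : NonZero s}} {{t≢0 : NonZero t}} {{k≢0 : NonZero k}}
                    (coprime : Coprime s t) where

  R ℓ : ℕ
  R = 2 * r
  ℓ = R * s * t * k

  Γ : Graph
  Γ = blowup k (Q r s t)

  size : ℕ → ℕ
  size x = if isEven x then s else t

  instance
    r≢0 : NonZero r
    r≢0 = >-nonZero (<-≤-trans z<s r≥2)

    R≢0 : NonZero R
    R≢0 = m*n≢0 2 r

    Rst≢0 : NonZero (R * s * t)
    Rst≢0 = m*n≢0 (R * s) t {{m*n≢0 R s}}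

    ℓ≢0 : NonZero ℓ
    ℓ≢0 = m*n≢0 (R * s * t) k


  size≢0 : ∀ x → NonZero (size x)
  size≢0 x with isEven x
  ... | true  = s≢0
  ... | false = t≢0

  size-mod2 : ∀ {x y} → x ≡ y mod 2 → size x ≡ size y
  size-mod2 p = cong (if_then s else t) (isEven-mod2 p)

  size-cases : ∀ x → (size x ≡ s × size (suc x) ≡ t) ⊎ (size x ≡ t × size (suc x) ≡ s)
  size-cases x rewrite isEven-suc x with isEven x
  ... | true  = inj₁ (refl , refl)
  ... | false = inj₂ (refl , refl)

  2∣R : 2 ∣ R
  2∣R = m∣m*n r

  R*size∣ℓ : ∀ x → R * size x ∣ ℓ
  R*size∣ℓ x with isEven x
  ... | true  = ∣-trans (m∣m*n t) (m∣m*n k)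
  ... | false = divides (s * k) (regroup R s t k)
    where
    regroup : ∀ R s t k → R * s * t * k ≡ s * k * (R * t)
    regroup R s t k = solve (R ∷ s ∷ t ∷ k ∷ [])

  R∣ℓ : R ∣ ℓ
  R∣ℓ = ∣-trans (m∣m*n (size 0)) (R*size∣ℓ 0)

  2∣ℓ : 2 ∣ ℓ
  2∣ℓ = ∣-trans 2∣R R∣ℓ

  layer : ℕ → Fin R
  layer x = fromℕ< (m%n<n x R)

  vertexAt : ℕ → V Γ
  vertexAt x = layer x , fromℕ< (m%n<n (x / R) (size (toℕ (layer x))) {{size≢0 (toℕ (layer x))}})

  toℕ-layer : ∀ x → toℕ (layer x) ≡ x mod R
  toℕ-layer x = mod-trans (mod-reflexive (toℕ-fromℕ< _)) (%-mod x)

  size-layer : ∀ x → size (toℕ (layer x)) ≡ size x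
  size-layer x = size-mod2 (mod-weaken 2∣R (toℕ-layer x))

  key : V Γ → ℕ
  key (m , u) = toℕ m + R * toℕ u

  key<R*size : ∀ m u → key (m , u) < R * size (toℕ m)
  key<R*size m u = +-*-< (toℕ<n m) (toℕ<n u)

  size-key : ∀ m u → size (key (m , u)) ≡ size (toℕ m)
  size-key m u = size-mod2 (mod-weaken 2∣R (+-multiple-mod (toℕ m) (toℕ u)))

  key-injective : ∀ {v w} → key v ≡ key w → v ≡ w
  key-injective {m , u} {m′ , u′} eq
    with refl ← toℕ-injective (mod-<⇒≡ (toℕ<n m) (toℕ<n m′)
                  (mod-trans (mod-sym (+-multiple-mod _ (toℕ u)))
                             (mod-trans (mod-reflexive eq) (+-multiple-mod _ (toℕ u′)))))
    = cong (m ,_) (toℕ-injective (*-cancelˡ-≡ (toℕ u) (toℕ u′) R (+-cancelˡ-≡ (toℕ m) _ _ eq)))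

  key-vertexAt : ∀ x → key (vertexAt x) ≡ x mod R * size x
  key-vertexAt x = begin
    key (vertexAt x)                            ≡⟨ cong₂ (λ a b → a + R * b) (toℕ-fromℕ< _) toℕ-index ⟩
    x % R + R * (x / R % z)                     ≈⟨ +-multiple-mod _ (x / R / z) ⟨
    x % R + R * (x / R % z) + R * z * (x / R / z) ≡⟨ regroup (x % R) (x / R % z) (x / R / z) R z ⟩
    x % R + R * (x / R % z + x / R / z * z)     ≡⟨ cong (λ y → x % R + R * y) (m≡m%n+[m/n]*n (x / R) z) ⟨
    x % R + R * (x / R)                         ≡⟨ cong (x % R +_) (*-comm R (x / R)) ⟩
    x % R + x / R * R                           ≡⟨ m≡m%n+[m/n]*n x R ⟨
    x                                           ∎
    where
    z = size x
    instance
      z≢0 : NonZero z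
      z≢0 = size≢0 x
    open ModReasoning (R * z)
    toℕ-index : toℕ (proj₂ (vertexAt x)) ≡ x / R % z
    toℕ-index = trans (toℕ-fromℕ< _) (%-cong (x / R) {{size≢0 (toℕ (layer x))}} (size-layer x))
    regroup : ∀ a b c d z → a + d * b + d * z * c ≡ a + d * (b + c * z)
    regroup a b c d z = solve (a ∷ b ∷ c ∷ d ∷ z ∷ [])

  key-vertexAt-mod-R : ∀ x → key (vertexAt x) ≡ x mod R
  key-vertexAt-mod-R x = mod-weaken (m∣m*n (size x)) (key-vertexAt x)

  key-vertexAt< : ∀ x → key (vertexAt x) < R * size x
  key-vertexAt< x = subst (λ z → key (vertexAt x) < R * z) (size-layer x) (key<R*size (layer x) _)

  vertexAt-key : ∀ v → vertexAt (key v) ≡ v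
  vertexAt-key (m , u) = key-injective (mod-<⇒≡ (key-vertexAt< (key (m , u)))
    (subst (λ z → key (m , u) < R * z) (sym (size-key m u)) (key<R*size m u))
    (key-vertexAt (key (m , u))))

  vertexAt-≡⇔ : ∀ x y → (vertexAt x ≡ vertexAt y) ⇔ (x ≡ y mod R * size x)
  vertexAt-≡⇔ x y = same-key⇒ ∘ cong key , key-injective ∘ ⇒same-key
    where
    size-y : x ≡ y mod R * size x → size y ≡ size x
    size-y x≡y = sym (size-mod2 (mod-weaken (∣-trans 2∣R (m∣m*n _)) x≡y))

    same-key⇒ : key (vertexAt x) ≡ key (vertexAt y) → x ≡ y mod R * size x
    same-key⇒ eq = begin
      x                ≈⟨ key-vertexAt x ⟨
      key (vertexAt x) ≡⟨ eq ⟩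
      key (vertexAt y) ≈⟨ subst (λ z → key (vertexAt y) ≡ y mod R * z) same-size (key-vertexAt y) ⟩
      y                ∎
      where
      open ModReasoning (R * size x)
      same-size : size y ≡ size x
      same-size = size-mod2 (mod-weaken 2∣R (mod-trans (mod-sym (key-vertexAt-mod-R y))
                    (mod-trans (mod-reflexive (sym eq)) (key-vertexAt-mod-R x))))

    ⇒same-key : x ≡ y mod R * size x → key (vertexAt x) ≡ key (vertexAt y)
    ⇒same-key x≡y = mod-<⇒≡ (key-vertexAt< x)
      (subst (λ z → key (vertexAt y) < R * z) (size-y x≡y) (key-vertexAt< y))
      (begin
        key (vertexAt x) ≈⟨ key-vertexAt x ⟩
        x                ≈⟨ x≡y ⟩
        y                ≈⟨ subst (λ z → key (vertexAt y) ≡ y mod R * z) (size-y x≡y) (key-vertexAt y) ⟨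
        key (vertexAt y) ∎)
      where open ModReasoning (R * size x)

  vt : Fin ℓ → V Γ
  vt i = vertexAt (toℕ i)

  position : V Γ → Fin ℓ
  position v@(m , u) = fromℕ< (<-≤-trans (key<R*size m u) (∣⇒≤ (R*size∣ℓ (toℕ m))))

  vt-position : ∀ v → vt (position v) ≡ v
  vt-position v = trans (cong vertexAt (toℕ-fromℕ< _)) (vertexAt-key v)

  size-φ : ∀ i → size (toℕ (φ i)) ≡ size (suc (toℕ i))
  size-φ i = size-mod2 (mod-weaken 2∣ℓ (toℕ-sucMod i))

  layer-φ : ∀ i → proj₁ (vt (φ i)) ≡ φ (proj₁ (vt i))
  layer-φ i = toℕ-mod-injective (begin
    toℕ (layer (toℕ (φ i)))     ≈⟨ toℕ-layer (toℕ (φ i)) ⟩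
    toℕ (φ i)                   ≈⟨ mod-weaken R∣ℓ (toℕ-sucMod i) ⟩
    suc (toℕ i)                 ≈⟨ +-congˡ-mod 1 (toℕ-layer (toℕ i)) ⟨
    suc (toℕ (layer (toℕ i)))   ≈⟨ toℕ-sucMod (layer (toℕ i)) ⟨
    toℕ (φ (layer (toℕ i)))     ∎)
    where open ModReasoning R

  arc : (v w : V Γ) → proj₁ w ≡ φ (proj₁ v) → E (Q r s t)
  arc (m , u) (.(φ m) , w) refl = m , u , w

  arc-ends : ∀ v w p → src (Q r s t) (arc v w p) ≡ v × tgt (Q r s t) (arc v w p) ≡ w
  arc-ends _ _ refl = refl , refl

  colour : ℕ → Fin k
  colour x = fromℕ< (m%n<n (x / (R * s * t)) k)

  edgeAt : Fin ℓ → E Γ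
  edgeAt i = arc (vt i) (vt (φ i)) (layer-φ i) , colour (toℕ i)

  src-edgeAt : ∀ i → src Γ (edgeAt i) ≡ vt i
  src-edgeAt i = proj₁ (arc-ends (vt i) (vt (φ i)) (layer-φ i))

  tgt-edgeAt : ∀ i → tgt Γ (edgeAt i) ≡ vt (φ i)
  tgt-edgeAt i = proj₂ (arc-ends (vt i) (vt (φ i)) (layer-φ i))

  edgeAt-injective : Injective _≡_ _≡_ edgeAt
  edgeAt-injective {i} {j} eq = toℕ-mod-injective (mod-combine (R * s * t) k i≡j-mod-Rst same-colour)
    where
    vt-i≡vt-j : vt i ≡ vt j
    vt-i≡vt-j = trans (sym (src-edgeAt i)) (trans (cong (src Γ) eq) (src-edgeAt j))

    vt-φi≡vt-φj : vt (φ i) ≡ vt (φ j)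
    vt-φi≡vt-φj = trans (sym (tgt-edgeAt i)) (trans (cong (tgt Γ) eq) (tgt-edgeAt j))

    i≡j-mod-R*size : toℕ i ≡ toℕ j mod R * size (toℕ i)
    i≡j-mod-R*size = proj₁ (vertexAt-≡⇔ (toℕ i) (toℕ j)) vt-i≡vt-j

    i≡j-mod-R*size-suc : toℕ i ≡ toℕ j mod R * size (suc (toℕ i))
    i≡j-mod-R*size-suc = +-cancelˡ-mod 1 (begin
      suc (toℕ i) ≈⟨ mod-weaken (R*size∣ℓ (suc (toℕ i))) (toℕ-sucMod i) ⟨
      toℕ (φ i)   ≈⟨ subst (λ z → toℕ (φ i) ≡ toℕ (φ j) mod R * z) (size-φ i)
                       (proj₁ (vertexAt-≡⇔ (toℕ (φ i)) (toℕ (φ j))) vt-φi≡vt-φj) ⟩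
      toℕ (φ j)   ≈⟨ mod-weaken (R*size∣ℓ (suc (toℕ i))) (toℕ-sucMod j) ⟩
      suc (toℕ j) ∎)
      where open ModReasoning (R * size (suc (toℕ i)))

    i≡j-mod-Rst : toℕ i ≡ toℕ j mod R * s * t
    i≡j-mod-Rst with size-cases (toℕ i)
    ... | inj₁ (size≡s , size-suc≡t) = crt R (Coprimality.sym coprime)
          (subst (λ z → toℕ i ≡ toℕ j mod R * z) size≡s i≡j-mod-R*size)
          (subst (λ z → toℕ i ≡ toℕ j mod R * z) size-suc≡t i≡j-mod-R*size-suc)
    ... | inj₂ (size≡t , size-suc≡s) = crt R (Coprimality.sym coprime)
          (subst (λ z → toℕ i ≡ toℕ j mod R * z) size-suc≡s i≡j-mod-R*size-suc)
          (subst (λ z → toℕ i ≡ toℕ j mod R * z) size≡t i≡j-mod-R*size)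

    same-colour : toℕ i / (R * s * t) % k ≡ toℕ j / (R * s * t) % k
    same-colour = trans (sym (toℕ-fromℕ< _)) (trans (cong (toℕ ∘ proj₂) eq) (toℕ-fromℕ< _))

  tour : Cycle Γ ℓ
  tour = record
    { edge     = edgeAt
    ; distinct = edgeAt-injective
    ; vert     = vt
    ; joins    = λ i → inj₁ (src-edgeAt i , tgt-edgeAt i) }

  size-pair : ∀ (m : Fin R) → size (toℕ m) * size (toℕ (φ m)) ≡ s * t
  size-pair m =
    trans (cong (size (toℕ m) *_) (size-mod2 (mod-weaken 2∣R (toℕ-sucMod m)))) (pair (size-cases (toℕ m)))
    where
    pair : ∀ {a b} → (a ≡ s × b ≡ t) ⊎ (a ≡ t × b ≡ s) → a * b ≡ s * t
    pair (inj₁ (refl , refl)) = refl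
    pair (inj₂ (refl , refl)) = *-comm t s

  ℓ-split : R * (s * t) * k ≡ ℓ
  ℓ-split = cong (_* k) (sym (*-assoc R s t))

  pairCode : (m : Fin R) → Fin (size (toℕ m)) → Fin (size (toℕ (φ m))) → Fin (s * t)
  pairCode m u w = cast (size-pair m) (combine u w)

  arcCode : (m : Fin R) → Fin (size (toℕ m)) → Fin (size (toℕ (φ m))) → Fin (R * (s * t))
  arcCode m u w = combine m (pairCode m u w)

  code : E Γ → Fin ℓ
  code ((m , u , w) , c) = cast ℓ-split (combine (arcCode m u w) c)

  code-injective : Injective _≡_ _≡_ code
  code-injective {(m , u , w) , c} {(m′ , u′ , w′) , c′} eq
    with outer ← cast-injective ℓ-split eq
    with refl ← combine-injectiveˡ m (pairCode m u w) m′ (pairCode m′ u′ w′)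
                  (combine-injectiveˡ (arcCode m u w) c (arcCode m′ u′ w′) c′ outer)
       | refl ← combine-injectiveʳ (arcCode m u w) c (arcCode m′ u′ w′) c′ outer
    with inner ← cast-injective (size-pair m) (combine-injectiveʳ m (pairCode m u w) m (pairCode m u′ w′)
                   (combine-injectiveˡ (arcCode m u w) c (arcCode m u′ w′) c outer))
    with refl ← combine-injectiveˡ u w u′ w′ inner
       | refl ← combine-injectiveʳ u w u′ w′ inner
    = refl

  tour-euler : EulerCycle tour
  tour-euler = injections⇒surjective edgeAt code edgeAt-injective code-injective

  vt-no-return : ∀ j → vt j ≢ vt (φ (φ j))
  vt-no-return j eq = <⇒≱ R>2 (∣⇒≤ (mod⇒∣ j≡j+2))
    where
    R>2 : 2 < R
    R>2 = ≤-trans (s≤s (s≤s (s≤s z≤n))) (*-monoʳ-≤ 2 r≥2)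

    j≡j+2 : toℕ j ≡ toℕ j + 2 mod R
    j≡j+2 = begin
      toℕ j             ≈⟨ mod-weaken (m∣m*n _) (proj₁ (vertexAt-≡⇔ (toℕ j) (toℕ (φ (φ j)))) eq) ⟩
      toℕ (φ (φ j))     ≡⟨ +-identityʳ _ ⟨
      toℕ (φ (φ j)) + 0 ≈⟨ mod-weaken R∣ℓ (φ²-rotation j) ⟩
      toℕ j + 2         ∎
      where open ModReasoning R

  affine-size : ∀ {σ} (α : Affine σ) {e} → offset α ≡ e mod 2 → ∀ i → size (toℕ (σ i)) ≡ size (toℕ i + e)
  affine-size α offset≡e i = size-mod2 (mod-trans (affine-parity 2∣ℓ α i) (+-congˡ-mod (toℕ i) offset≡e))

  affine-respects : ∀ {σ} (α : Affine σ) → offset α ≡ 0 mod 2 → RespectsVert tour σ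
  affine-respects {σ} α even {i} {j} eq = proj₂ (vertexAt-≡⇔ (toℕ (σ i)) (toℕ (σ j)))
    (subst (λ z → toℕ (σ i) ≡ toℕ (σ j) mod R * z) (sym same-size)
      (proj₁ (affine-mod⇔ (R*size∣ℓ (toℕ i)) α i j) (proj₁ (vertexAt-≡⇔ (toℕ i) (toℕ j)) eq)))
    where
    same-size : size (toℕ (σ i)) ≡ size (toℕ i)
    same-size = trans (affine-size α even i) (cong size (+-identityʳ (toℕ i)))

  affine-induced : ∀ {π} (α : Affine π) → offset (vertexPart-affine α) ≡ 0 mod 2 → Induced tour π
  affine-induced {π} α even =
    cycle-automorphism tour tour-euler position vt-position σ↔ π↔
      (affine-respects σ-affine even)
      (affine-respects σ⁻¹-affine
        (subst (_≡ 0 mod 2) (sym (offset-inverse σ-affine (Inverse.strictlyInverseˡ σ↔))) even))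
      (ends-match α)
    where
    σ-affine : Affine (vertexPart α)
    σ-affine = vertexPart-affine α

    σ↔ π↔ : Fin ℓ ↔ Fin ℓ
    σ↔ = injective⇒↔ (vertexPart α) (affine-injective σ-affine)
    π↔ = injective⇒↔ π (affine-injective α)

    σ⁻¹-affine : Affine (Inverse.from σ↔)
    σ⁻¹-affine = affine-inverse σ-affine (Inverse.strictlyInverseˡ σ↔)

    ends-match : (α : Affine π) → ∀ i →
                 SameEnds (vt (vertexPart α i)) (vt (vertexPart α (φ i))) (vt (π i)) (vt (φ (π i)))
    ends-match (rotation c a F)   i = inj₁ (refl , cong vt (rotation-φ {π = π} F i))
    ends-match (reflection c a F) i = inj₂ (refl , cong vt (sym (reflection-φ {π = π} F i)))

  ⟨φ²,τ⟩⊆H : ∀ {π} → Gen (φ ∘ φ ∷ τ ∷ []) π → InH tour π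
  ⟨φ²,τ⟩⊆H π∈⟨φ²,τ⟩ =
    euler⇒InH tour tour-euler (Gen-induced tour generators π∈⟨φ²,τ⟩) (⟨φ²,τ⟩⊆⟨φ,τ⟩ π∈⟨φ²,τ⟩)
    where
    generators : ∀ {f} → f ∈ (φ ∘ φ ∷ τ ∷ []) → Induced tour f
    generators (here refl)         = affine-induced (rotation 0 2 φ²-rotation) (congruent 0 1 refl)
    generators (there (here refl)) = affine-induced (reflection 1 0 τ-reflection) (congruent 0 1 refl)

  reversal⇒size-suc∣size : ∀ {π} (A : Aut Γ) → Induces tour A π → (α : Affine π) →
    offset (vertexPart-affine α) ≡ 1 mod 2 → ∀ i → size (suc (toℕ i)) ∣ size (toℕ i)
  reversal⇒size-suc∣size {π} A A-π α odd i = *-cancelˡ-∣ R (mod⇒∣ i≡i+Rz)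
    where
    σ : Fin ℓ → Fin ℓ
    σ = vertexPart α

    z z′ : ℕ
    z  = size (toℕ i)
    z′ = size (suc (toℕ i))

    j : Fin ℓ
    j = fromℕ< (m%n<n (toℕ i + R * z) ℓ)

    toℕ-j : toℕ j ≡ toℕ i + R * z mod ℓ
    toℕ-j = mod-trans (mod-reflexive (toℕ-fromℕ< _)) (%-mod _)

    vt-i≡vt-j : vt i ≡ vt j
    vt-i≡vt-j = proj₂ (vertexAt-≡⇔ (toℕ i) (toℕ j))
                  (mod-trans (∣⇒mod ∣-refl) (mod-sym (mod-weaken (R*size∣ℓ (toℕ i)) toℕ-j)))

    vt-σi≡vt-σj : vt (σ i) ≡ vt (σ j)
    vt-σi≡vt-σj = trans (sym (vertex-image tour vt-no-return A A-π α i))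
                        (trans (cong (Inverse.to (Aut.vmap A)) vt-i≡vt-j) (vertex-image tour vt-no-return A A-π α j))

    σi≡σj : toℕ (σ i) ≡ toℕ (σ j) mod R * z′
    σi≡σj = subst (λ y → toℕ (σ i) ≡ toℕ (σ j) mod R * y)
              (trans (affine-size (vertexPart-affine α) odd i) (cong size (+-comm (toℕ i) 1)))
              (proj₁ (vertexAt-≡⇔ (toℕ (σ i)) (toℕ (σ j))) vt-σi≡vt-σj)

    i≡i+Rz : toℕ i ≡ toℕ i + R * z mod R * z′
    i≡i+Rz = mod-trans (proj₂ (affine-mod⇔ (R*size∣ℓ (suc (toℕ i))) (vertexPart-affine α) i j) σi≡σj)
                       (mod-weaken (R*size∣ℓ (suc (toℕ i))) toℕ-j)

  parity-reversal-impossible : 2 ≤ s * t → ∀ {π} (A : Aut Γ) → Induces tour A π → (α : Affine π) →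
                               ¬ (offset (vertexPart-affine α) ≡ 1 mod 2)
  parity-reversal-impossible st≥2 A A-π α odd = <-irrefl refl (subst (2 ≤_) (cong₂ _*_ s≡1 t≡1) st≥2)
    where
    p₀ : Fin ℓ
    p₀ = fromℕ< (>-nonZero⁻¹ ℓ)

    toℕ-p₀ : toℕ p₀ ≡ 0
    toℕ-p₀ = toℕ-fromℕ< _

    toℕ-φp₀ : toℕ (φ p₀) ≡ 1 mod 2
    toℕ-φp₀ = mod-weaken 2∣ℓ (mod-trans (toℕ-sucMod p₀) (mod-reflexive (cong suc toℕ-p₀)))

    t∣s : t ∣ s
    t∣s = subst₂ _∣_ (cong (size ∘ suc) toℕ-p₀) (cong size toℕ-p₀) (reversal⇒size-suc∣size A A-π α odd p₀)

    s∣t : s ∣ t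
    s∣t = subst₂ _∣_ (size-mod2 (+-congˡ-mod 1 toℕ-φp₀)) (size-mod2 toℕ-φp₀)
                     (reversal⇒size-suc∣size A A-π α odd (φ p₀))

    s≡1 : s ≡ 1
    s≡1 = coprime-∣⇒≡1 coprime s∣t

    t≡1 : t ≡ 1
    t≡1 = coprime-∣⇒≡1 (Coprimality.sym coprime) t∣s

  H⊆⟨φ²,τ⟩ : 2 ≤ s * t → ∀ {π} → InH tour π → Gen (φ ∘ φ ∷ τ ∷ []) π
  H⊆⟨φ²,τ⟩ st≥2 {π} (A , _ , A-π , π∈D) = classify (D⇒affine π∈D)
    where
    classify : (α : Affine π) → Gen (φ ∘ φ ∷ τ ∷ []) π
    classify α = [ vertex-even⇒⟨φ²,τ⟩ 2∣ℓ α , ⊥-elim ∘ parity-reversal-impossible st≥2 A A-π α ]′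
                   (mod2-cases (offset (vertexPart-affine α)))

lemma7p6 : (r s t k : ℕ) → 2 ≤ r → 1 ≤ s → 1 ≤ t → 2 ≤ s * t → gcd s t ≡ 1 → 1 ≤ k →
    Σ[ ℓ ∈ ℕ ] Σ[ C ∈ Cycle (blowup k (Q r s t)) ℓ ]
      (EulerCycle C × Symmetrical C
        × (∀ (π : Fin ℓ → Fin ℓ) → InH C π ⇔ Gen (φ ∘ φ ∷ τ ∷ []) π))
lemma7p6 r s t k r≥2 s≥1 t≥1 st≥2 gcd≡1 k≥1 =
  ℓ , tour , tour-euler , ⟨φ²,τ⟩⊆H (gen (here refl)) , λ π → H⊆⟨φ²,τ⟩ st≥2 , ⟨φ²,τ⟩⊆H
  where
  open Construction r s t k r≥2 {{>-nonZero s≥1}} {{>-nonZero t≥1}} {{>-nonZero k≥1}} (gcd≡1⇒coprime gcd≡1)
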